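{- Let $V=V_1\sqcup V_2\sqcup V_3$ be a tripartition of a vertex set, let $F$ be a set of tripartite $3$-edges, and let $G$ be obtained from $T_{V_1,V_2,V_3}$ by adding the $3$-edges of $F$ and removing all $3$-edges of $T_{V_1,V_2,V_3}$ that contain a pair overused by $F$. Then $G$ is $F_{3,2}$-free.
   Context: A $3$-graph is a pair $(V,E)$ with $E$ a set of $3$-subsets of $V$. $T_{V_1,V_2,V_3}$ is the $3$-graph on $V$ whose $3$-edges are all triples with two vertices in $V_i$ and one in $V_{i+1}$ for some $i\in\{1,2,3\}$ (indices mod $3$). A tripartite $3$-edge is a triple $x_1x_2x_3$ with $x_i\in V_i$. A pair of vertices is overused by $F$ if it is contained in at least two $3$-edges of $F$. $F_{3,2}$ is the $3$-graph on $\{1,\dots,5\}$ with $3$-edges $123,124,125,345$; $F_{3,2}$-free means no subgraph isomorphic to $F_{3,2}$. -}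

module Defs where

open import Data.Fin using (Fin; zero; suc)
open import Data.Product using (Σ; _×_; _,_; ∃)
open import Data.Sum using (_⊎_)
open import Relation.Nullary using (¬_)
open import Relation.Binary.PropositionalEquality using (_≡_; _≢_)
open import Function.Definitions using (Injective)

next : Fin 3 → Fin 3
next zero = suc zero
next (suc zero) = suc (suc zero)
next (suc (suc zero)) = zero

module _ {V : Set} (part : V → Fin 3) where

  TEdge : V → V → V → Set
  TEdge a b c =
      (part a ≡ part b × part c ≡ next (part a))
    ⊎ (part a ≡ part c × part b ≡ next (part a))
    ⊎ (part b ≡ part c × part a ≡ next (part b))

  -- F is a set of tripartite 3-edges; each tripartite edge x1x2x3 (xi ∈ Vi)
  -- is represented by the ordered triple (x1 , x2 , x3).
  Tripartite : (V → V → V → Set) → Set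
  Tripartite F = ∀ x y z → F x y z →
    (part x ≡ zero) × (part y ≡ suc zero) × (part z ≡ suc (suc zero))

module _ {V : Set} (F : V → V → V → Set) where

  Triple : Set
  Triple = V × V × V

  _∈T_ : V → Triple → Set
  u ∈T (x , y , z) = u ≡ x ⊎ u ≡ y ⊎ u ≡ z

  InF : Triple → Set
  InF (x , y , z) = F x y z

  Overused : V → V → Set
  Overused u v = u ≢ v × Σ Triple λ e → Σ Triple λ e' →
    e ≢ e' × InF e × InF e' × u ∈T e × v ∈T e × u ∈T e' × v ∈T e'

  FEdge : V → V → V → Set
  FEdge a b c = F a b c ⊎ F a c b ⊎ F b a c ⊎ F b c a ⊎ F c a b ⊎ F c b a

module _ {V : Set} (part : V → Fin 3) (F : V → V → V → Set) where

  Distinct3 : V → V → V → Set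
  Distinct3 a b c = a ≢ b × a ≢ c × b ≢ c

  GEdge : V → V → V → Set
  GEdge a b c = Distinct3 a b c ×
    ( (TEdge part a b c × ¬ Overused F a b × ¬ Overused F a c × ¬ Overused F b c)
    ⊎ FEdge F a b c )

ContainsF32 : {V : Set} → (V → V → V → Set) → Set
ContainsF32 {V} E = Σ (Fin 5 → V) λ f → Injective _≡_ _≡_ f ×
  E (f v1) (f v2) (f v3) × E (f v1) (f v2) (f v4) ×
  E (f v1) (f v2) (f v5) × E (f v3) (f v4) (f v5)
  where
  v1 v2 v3 v4 v5 : Fin 5
  v1 = zero
  v2 = suc zero
  v3 = suc (suc zero)
  v4 = suc (suc (suc zero))
  v5 = suc (suc (suc (suc zero)))

F32-free : {V : Set} → (V → V → V → Set) → Set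
F32-free E = ¬ ContainsF32 E

-- Label a copy of F_{3,2} in G by 1, ..., 5 (0F, ..., 4F in the code). The classes
-- of 1 and 2 have a unique completion to a T-edge and, if they differ, a unique
-- completion to a rainbow (tripartite) edge. So if the spokes 123, 124, 125 are all T-edges or all F-edges, the
-- vertices 3, 4, 5 lie in one class and 345 is no edge of G. If exactly one
-- spoke is an F-edge, 345 has two vertices in the T-completion class c and
-- one in the rainbow class, which is the class before c, so again 345 is
-- neither a T-edge nor rainbow. If exactly two spokes are F-edges, the pair
-- 12 is overused, so the third spoke was removed from T.
module Submission where

open import Defs
open import Data.Fin using (Fin)
open import Data.Fin.Patterns using (0F; 1F; 2F; 3F; 4F)
open import Data.Fin.Properties using (_≟_; all?)
open import Data.Empty using (⊥)
open import Data.Product using (Σ; _×_; _,_)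
open import Data.Sum using (_⊎_; inj₁; inj₂)
open import Function using (id; _∘_)
open import Function.Definitions using (Injective)
open import Function.Consequences using (contraInjective)
open import Relation.Nullary using (¬_; Dec)
open import Relation.Nullary.Decidable using (from-yes; _×-dec_; _⊎-dec_; _→-dec_; ¬?)
open import Relation.Binary.PropositionalEquality using (_≡_; _≢_; refl; sym; subst)

TPattern : Fin 3 → Fin 3 → Fin 3 → Set
TPattern = TEdge id

Rainbow : Fin 3 → Fin 3 → Fin 3 → Set
Rainbow x y z = x ≢ y × x ≢ z × y ≢ z

Admissible : Fin 3 → Fin 3 → Fin 3 → Set
Admissible x y z = TPattern x y z ⊎ Rainbow x y z

TPattern? : ∀ x y z → Dec (TPattern x y z)
TPattern? x y z =
  (x ≟ y ×-dec z ≟ next x) ⊎-dec (x ≟ z ×-dec y ≟ next x) ⊎-dec (y ≟ z ×-dec x ≟ next y)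

Rainbow? : ∀ x y z → Dec (Rainbow x y z)
Rainbow? x y z = ¬? (x ≟ y) ×-dec ¬? (x ≟ z) ×-dec ¬? (y ≟ z)

Admissible? : ∀ x y z → Dec (Admissible x y z)
Admissible? x y z = TPattern? x y z ⊎-dec Rainbow? x y z

Rainbow-swap₁₂ : ∀ {x y z} → Rainbow x y z → Rainbow y x z
Rainbow-swap₁₂ (x≢y , x≢z , y≢z) = x≢y ∘ sym , y≢z , x≢z

Rainbow-swap₂₃ : ∀ {x y z} → Rainbow x y z → Rainbow x z y
Rainbow-swap₂₃ (x≢y , x≢z , y≢z) = x≢z , x≢y , y≢z ∘ sym

Admissible-rotate : ∀ {x y z} → Admissible x y z → Admissible y z x
Admissible-rotate {x} {y} {z} = from-yes
  (all? λ x → all? λ y → all? λ z → Admissible? x y z →-dec Admissible? y z x) x y z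

TPattern-completion-unique : ∀ {x y z w} → TPattern x y z → TPattern x y w → z ≡ w
TPattern-completion-unique {x} {y} {z} {w} = from-yes
  (all? λ x → all? λ y → all? λ z → all? λ w →
    TPattern? x y z →-dec TPattern? x y w →-dec z ≟ w) x y z w

Rainbow-completion-unique : ∀ {x y z w} → Rainbow x y z → Rainbow x y w → z ≡ w
Rainbow-completion-unique {x} {y} {z} {w} = from-yes
  (all? λ x → all? λ y → all? λ z → all? λ w →
    Rainbow? x y z →-dec Rainbow? x y w →-dec z ≟ w) x y z w

¬Admissible-monochromatic : ∀ {x} → ¬ Admissible x x x
¬Admissible-monochromatic {x} = from-yes (all? λ x → ¬? (Admissible? x x x)) x

¬Admissible-mixed : ∀ {x y r c} → Rainbow x y r → TPattern x y c → ¬ Admissible r c c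
¬Admissible-mixed {x} {y} {r} {c} = from-yes
  (all? λ x → all? λ y → all? λ r → all? λ c →
    Rainbow? x y r →-dec TPattern? x y c →-dec ¬? (Admissible? r c c)) x y r c

TPattern-fan : ∀ {x y a b c} →
  TPattern x y a → TPattern x y b → TPattern x y c → ¬ Admissible a b c
TPattern-fan ta tb tc
  with refl ← TPattern-completion-unique ta tb | refl ← TPattern-completion-unique ta tc
  = ¬Admissible-monochromatic

Rainbow-fan : ∀ {x y a b c} →
  Rainbow x y a → Rainbow x y b → Rainbow x y c → ¬ Admissible a b c
Rainbow-fan ra rb rc
  with refl ← Rainbow-completion-unique ra rb | refl ← Rainbow-completion-unique ra rc
  = ¬Admissible-monochromatic

mixed-fan : ∀ {x y r c c′} →
  Rainbow x y r → TPattern x y c → TPattern x y c′ → ¬ Admissible r c c′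
mixed-fan rr tc tc′ with refl ← TPattern-completion-unique tc tc′ = ¬Admissible-mixed rr tc

module _ {V : Set} (F : V → V → V → Set) where

  infix 4 _∈_ _⊆_

  _∈_ : V → Triple F → Set
  _∈_ = _∈T_ F

  _⊆_ : Triple F → Triple F → Set
  e ⊆ e′ = ∀ {u} → u ∈ e → u ∈ e′

  ∈-swap₁₂ : ∀ {u x y z} → u ∈ (x , y , z) → u ∈ (y , x , z)
  ∈-swap₁₂ (inj₁ u≡x)        = inj₂ (inj₁ u≡x)
  ∈-swap₁₂ (inj₂ (inj₁ u≡y)) = inj₁ u≡y
  ∈-swap₁₂ (inj₂ (inj₂ u≡z)) = inj₂ (inj₂ u≡z)

  ∈-swap₂₃ : ∀ {u x y z} → u ∈ (x , y , z) → u ∈ (x , z , y)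
  ∈-swap₂₃ (inj₁ u≡x)        = inj₁ u≡x
  ∈-swap₂₃ (inj₂ (inj₁ u≡y)) = inj₂ (inj₂ u≡y)
  ∈-swap₂₃ (inj₂ (inj₂ u≡z)) = inj₂ (inj₁ u≡z)

  ∉-injective : ∀ {A : Set} {f : A → V} → Injective _≡_ _≡_ f →
    ∀ {i j k l} → i ≢ j → i ≢ k → i ≢ l → ¬ f i ∈ (f j , f k , f l)
  ∉-injective f-inj i≢j _ _ (inj₁ fi≡fj)        = i≢j (f-inj fi≡fj)
  ∉-injective f-inj _ i≢k _ (inj₂ (inj₁ fi≡fk)) = i≢k (f-inj fi≡fk)
  ∉-injective f-inj _ _ i≢l (inj₂ (inj₂ fi≡fl)) = i≢l (f-inj fi≡fl)

  FEdge-triple : ∀ {a b c} → FEdge F a b c →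
    Σ (Triple F) λ e → InF F e × (a , b , c) ⊆ e × e ⊆ (a , b , c)
  FEdge-triple (inj₁ Fabc)                          = _ , Fabc , id , id
  FEdge-triple (inj₂ (inj₁ Facb))                   = _ , Facb , ∈-swap₂₃ , ∈-swap₂₃
  FEdge-triple (inj₂ (inj₂ (inj₁ Fbac)))            = _ , Fbac , ∈-swap₁₂ , ∈-swap₁₂
  FEdge-triple (inj₂ (inj₂ (inj₂ (inj₁ Fbca))))     =
    _ , Fbca , ∈-swap₂₃ ∘ ∈-swap₁₂ , ∈-swap₁₂ ∘ ∈-swap₂₃
  FEdge-triple (inj₂ (inj₂ (inj₂ (inj₂ (inj₁ Fcab))))) =
    _ , Fcab , ∈-swap₁₂ ∘ ∈-swap₂₃ , ∈-swap₂₃ ∘ ∈-swap₁₂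
  FEdge-triple (inj₂ (inj₂ (inj₂ (inj₂ (inj₂ Fcba))))) =
    _ , Fcba , ∈-swap₁₂ ∘ ∈-swap₂₃ ∘ ∈-swap₁₂ , ∈-swap₁₂ ∘ ∈-swap₂₃ ∘ ∈-swap₁₂

  FEdges-overuse : ∀ {a b c d} → a ≢ b → ¬ c ∈ (a , b , d) →
    FEdge F a b c → FEdge F a b d → Overused F a b
  FEdges-overuse {c = c} a≢b c∉abd abc abd =
    let (e , Fe , abc⊆e , _) = FEdge-triple abc
        (e′ , Fe′ , abd⊆e′ , e′⊆abd) = FEdge-triple abd
        e≢e′ = λ e≡e′ → c∉abd (e′⊆abd (subst (c ∈_) e≡e′ (abc⊆e (inj₂ (inj₂ refl)))))
    in a≢b , e , e′ , e≢e′ , Fe , Fe′ ,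
       abc⊆e (inj₁ refl) , abc⊆e (inj₂ (inj₁ refl)) , abd⊆e′ (inj₁ refl) , abd⊆e′ (inj₂ (inj₁ refl))

module _ {V : Set} (part : V → Fin 3) {F : V → V → V → Set} (tripartite : Tripartite part F) where

  F-rainbow : ∀ {x y z} → F x y z → Rainbow (part x) (part y) (part z)
  F-rainbow {x} {y} {z} Fxyz with tripartite x y z Fxyz
  ... | px , py , pz rewrite px | py | pz = (λ ()) , (λ ()) , (λ ())

  FEdge-rainbow : ∀ {a b c} → FEdge F a b c → Rainbow (part a) (part b) (part c)
  FEdge-rainbow (inj₁ Fabc)                              = F-rainbow Fabc
  FEdge-rainbow (inj₂ (inj₁ Facb))                       = Rainbow-swap₂₃ (F-rainbow Facb)
  FEdge-rainbow (inj₂ (inj₂ (inj₁ Fbac)))                = Rainbow-swap₁₂ (F-rainbow Fbac)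
  FEdge-rainbow (inj₂ (inj₂ (inj₂ (inj₁ Fbca))))         =
    Rainbow-swap₁₂ (Rainbow-swap₂₃ (F-rainbow Fbca))
  FEdge-rainbow (inj₂ (inj₂ (inj₂ (inj₂ (inj₁ Fcab))))) =
    Rainbow-swap₂₃ (Rainbow-swap₁₂ (F-rainbow Fcab))
  FEdge-rainbow (inj₂ (inj₂ (inj₂ (inj₂ (inj₂ Fcba))))) =
    Rainbow-swap₁₂ (Rainbow-swap₂₃ (Rainbow-swap₁₂ (F-rainbow Fcba)))

  GEdgeView : V → V → V → Set
  GEdgeView a b c = (TEdge part a b c × ¬ Overused F a b)
                  ⊎ (FEdge F a b c × Rainbow (part a) (part b) (part c))

  GEdge-view : ∀ {a b c} → GEdge part F a b c → GEdgeView a b c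
  GEdge-view (_ , inj₁ (t , ¬ab-overused , _)) = inj₁ (t , ¬ab-overused)
  GEdge-view (_ , inj₂ f)                      = inj₂ (f , FEdge-rainbow f)

  GEdge-admissible : ∀ {a b c} → GEdge part F a b c → Admissible (part a) (part b) (part c)
  GEdge-admissible (_ , inj₁ (t , _)) = inj₁ t
  GEdge-admissible (_ , inj₂ f)       = inj₂ (FEdge-rainbow f)

proposition4p20 : {V : Set} (part : V → Fin 3) (F : V → V → V → Set) →
    Tripartite part F → F32-free (GEdge part F)
proposition4p20 part F tripartite (f , f-inj , e123 , e124 , e125 , e345) =
  spokes (GEdge-view part tripartite e123) (GEdge-view part tripartite e124)
         (GEdge-view part tripartite e125)
  where
  e345-admissible : Admissible (part (f 2F)) (part (f 3F)) (part (f 4F))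
  e345-admissible = GEdge-admissible part tripartite e345

  overuse : ∀ {i j} → i ≢ 0F → i ≢ 1F → i ≢ j →
    FEdge F (f 0F) (f 1F) (f i) → FEdge F (f 0F) (f 1F) (f j) → Overused F (f 0F) (f 1F)
  overuse i≢0 i≢1 i≢j =
    FEdges-overuse F (contraInjective {f = f} _≡_ f-inj λ ()) (∉-injective F f-inj i≢0 i≢1 i≢j)

  View : Fin 5 → Set
  View i = GEdgeView part tripartite (f 0F) (f 1F) (f i)

  spokes : View 2F → View 3F → View 4F → ⊥
  spokes (inj₁ (t₃ , _)) (inj₁ (t₄ , _)) (inj₁ (t₅ , _)) = TPattern-fan t₃ t₄ t₅ e345-admissible
  spokes (inj₂ (_ , r₃)) (inj₂ (_ , r₄)) (inj₂ (_ , r₅)) = Rainbow-fan r₃ r₄ r₅ e345-admissible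
  spokes (inj₂ (_ , r₃)) (inj₁ (t₄ , _)) (inj₁ (t₅ , _)) = mixed-fan r₃ t₄ t₅ e345-admissible
  spokes (inj₁ (t₃ , _)) (inj₂ (_ , r₄)) (inj₁ (t₅ , _)) =
    mixed-fan r₄ t₅ t₃ (Admissible-rotate e345-admissible)
  spokes (inj₁ (t₃ , _)) (inj₁ (t₄ , _)) (inj₂ (_ , r₅)) =
    mixed-fan r₅ t₃ t₄ (Admissible-rotate (Admissible-rotate e345-admissible))
  spokes (inj₂ (f₃ , _)) (inj₂ (f₄ , _)) (inj₁ (_ , ¬ov)) = ¬ov (overuse (λ ()) (λ ()) (λ ()) f₃ f₄)
  spokes (inj₂ (f₃ , _)) (inj₁ (_ , ¬ov)) (inj₂ (f₅ , _)) = ¬ov (overuse (λ ()) (λ ()) (λ ()) f₃ f₅)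
  spokes (inj₁ (_ , ¬ov)) (inj₂ (f₄ , _)) (inj₂ (f₅ , _)) = ¬ov (overuse (λ ()) (λ ()) (λ ()) f₄ f₅)
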